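{- The desuspension defines a morphism of categories with families $\mathrm{D}:\mathrm{Syn}(\mathsf{CaTT})\to\mathrm{Syn}(\mathsf{MCaTT})$.
   Context: $\mathsf{CaTT}$ is the Finster–Mimram type theory for weak $\omega$-categories (types $\star$, $\mathrm{Hom}_Atu$; terms variables, $\mathsf{op}_{\Gamma,A}[\gamma]$, $\mathsf{coh}_{\Gamma,A}[\gamma]$ for ps-contexts $\Gamma$). $\mathsf{MCaTT}$ is the type theory with a unit type $\mathbb{1}$ (constant $()$, $\eta$-rule), types $\mathrm{Hom}_Atu$, and term constructors $\mathsf{mop}_{\Gamma,A}[\gamma]$, $\mathsf{mcoh}_{\Gamma,A}[\gamma]$ whose argument $\gamma$ is a substitution into $\mathrm{D}\Gamma$. $\mathrm{Syn}(T)$ is the syntactic category of a theory $T$ (contexts and substitutions up to definitional equality) with its category-with-families structure (types and terms in a context). A morphism of categories with families is a functor preserving types, terms, the terminal object and context comprehension on the nose. The desuspension $\mathrm{D}$ is given by $\mathrm{D}\emptyset=\emptyset$, $\mathrm{D}(\Gamma,x:A)=(\mathrm{D}\Gamma,x:\mathrm{D}A)$, $\mathrm{D}\star=\mathbb{1}$, $\mathrm{D}(\mathrm{Hom}_Atu)=\mathrm{Hom}_{\mathrm{D}A}(\mathrm{D}t)(\mathrm{D}u)$, $\mathrm{D}x=x$, $\mathrm{D}(\mathsf{op}_{\Gamma,A}[\gamma])=\mathsf{mop}_{\Gamma,A}[\mathrm{D}\gamma]$, $\mathrm{D}(\mathsf{coh}_{\Gamma,A}[\gamma])=\mathsf{mcoh}_{\Gamma,A}[\mathrm{D}\gamma]$,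 $\mathrm{D}\langle\gamma,x\mapsto t\rangle=\langle\mathrm{D}\gamma,x\mapsto\mathrm{D}t\rangle$; it preserves derivability and commutes with substitution. -}

module Defs where

-- Ctx n is a context with n
-- variables; variable  zero  is the most recently bound one.
-- Sub m n  is a substitution  Δ → Γ  with |Δ| = m, |Γ| = n, i.e. a list
-- of n terms in scope m (the last component is the image of variable zero).

open import Data.Nat using (ℕ; zero; suc; _⊔_; _≤_; _≤ᵇ_; _≡ᵇ_)
open import Data.Fin using (Fin; zero; suc)
open import Data.Bool using (Bool; true; false; not; if_then_else_)
open import Data.Vec using (Vec; []; _∷_)
open import Data.Fin.Subset using (Subset; ⁅_⁆; _∪_; ⊥; ⊤)
open import Relation.Binary.PropositionalEquality using (_≡_)

private
  variable
    k m n : ℕ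

infixl 5 _▹_
infixl 5 _,ₛ_

data Ctx : ℕ → Set
data Ty  : ℕ → Set
data Tm  : ℕ → Set
data Sub : ℕ → ℕ → Set

data Ctx where
  ∅   : Ctx 0
  _▹_ : Ctx n → Ty n → Ctx (suc n)

data Ty where
  ⋆   : Ty n
  Hom : Ty n → Tm n → Tm n → Ty n

data Tm where
  var : Fin n → Tm n
  op  : Ctx k → Ty k → Sub n k → Tm n
  coh : Ctx k → Ty k → Sub n k → Tm n

data Sub where
  ⟨⟩   : Sub m 0
  _,ₛ_ : Sub m n → Tm m → Sub m (suc n)

renTy  : (Fin n → Fin m) → Ty n → Ty m
renTm  : (Fin n → Fin m) → Tm n → Tm m
renSub : (Fin n → Fin m) → Sub n k → Sub m k
renTy ρ ⋆ = ⋆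
renTy ρ (Hom A t u) = Hom (renTy ρ A) (renTm ρ t) (renTm ρ u)
renTm ρ (var i) = var (ρ i)
renTm ρ (op Γ A γ) = op Γ A (renSub ρ γ)
renTm ρ (coh Γ A γ) = coh Γ A (renSub ρ γ)
renSub ρ ⟨⟩ = ⟨⟩
renSub ρ (γ ,ₛ t) = renSub ρ γ ,ₛ renTm ρ t

wkTy : Ty n → Ty (suc n)
wkTy = renTy suc

wkSub : Sub n k → Sub (suc n) k
wkSub = renSub suc

ctxTy : Ctx n → Fin n → Ty n
ctxTy (Γ ▹ A) zero    = wkTy A
ctxTy (Γ ▹ A) (suc i) = wkTy (ctxTy Γ i)

lookupSub : Sub m n → Fin n → Tm m
lookupSub (γ ,ₛ t) zero    = t
lookupSub (γ ,ₛ t) (suc i) = lookupSub γ i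

_[_]Ty : Ty n → Sub m n → Ty m
_[_]Tm : Tm n → Sub m n → Tm m
_∘ₛ_   : Sub k n → Sub m k → Sub m n
⋆ [ γ ]Ty = ⋆
Hom A t u [ γ ]Ty = Hom (A [ γ ]Ty) (t [ γ ]Tm) (u [ γ ]Tm)
var i [ γ ]Tm = lookupSub γ i
op Γ A δ [ γ ]Tm = op Γ A (δ ∘ₛ γ)
coh Γ A δ [ γ ]Tm = coh Γ A (δ ∘ₛ γ)
⟨⟩ ∘ₛ δ = ⟨⟩
(γ ,ₛ t) ∘ₛ δ = (γ ∘ₛ δ) ,ₛ (t [ δ ]Tm)

idSub : (n : ℕ) → Sub n n
idSub zero    = ⟨⟩
idSub (suc n) = wkSub (idSub n) ,ₛ var zero

pSub : (n : ℕ) → Sub (suc n) n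
pSub n = wkSub (idSub n)

qTm : (n : ℕ) → Tm (suc n)
qTm n = var zero

varsTy  : Ty n → Subset n
varsTm  : Tm n → Subset n
varsSub : Sub n k → Subset n
varsTy ⋆ = ⊥
varsTy (Hom A t u) = varsTy A ∪ (varsTm t ∪ varsTm u)
varsTm (var i) = ⁅ i ⁆
varsTm (op Γ A γ) = varsSub γ
varsTm (coh Γ A γ) = varsSub γ
varsSub ⟨⟩ = ⊥
varsSub (γ ,ₛ t) = varsSub γ ∪ varsTm t

dimTy : Ty n → ℕ
dimTy ⋆ = 0
dimTy (Hom A t u) = suc (dimTy A)

dimCtx : Ctx n → ℕ
dimCtx ∅ = 0
dimCtx (Γ ▹ A) = dimCtx Γ ⊔ dimTy A

-- drop: remove the last (most recently bound) variable of a subcontext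
dropLast : Subset n → Subset n
dropLast [] = []
dropLast (true ∷ s)  = false ∷ s
dropLast (false ∷ s) = false ∷ dropLast s

-- Var(∂ᵢ⁻ Γ) and Var(∂ᵢ⁺ Γ) (Finster–Mimram), for Γ of the shape of a
-- ps-context  (x:⋆), y₁:A₁, f₁:B₁, …, yₖ:Aₖ, fₖ:Bₖ :
--   ∂ᵢ⁻(x:⋆) = (x:⋆)
--   ∂ᵢ⁻(Γ,y:A,f:B) = ∂ᵢ⁻Γ if dim A ≥ i,  ∂ᵢ⁻Γ,y:A,f:B otherwise
--   ∂ᵢ⁺(x:⋆) = (x:⋆)
--   ∂ᵢ⁺(Γ,y:A,f:B) = ∂ᵢ⁺Γ if dim A > i,  drop(∂ᵢ⁺Γ),y:A if dim A = i,
--                    ∂ᵢ⁺Γ,y:A,f:B otherwise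
srcVars : ℕ → Ctx n → Subset n
srcVars i ∅ = []
srcVars i (∅ ▹ A) = true ∷ []
srcVars i (Γ ▹ A ▹ B) =
  let b = not (i ≤ᵇ dimTy A) in b ∷ b ∷ srcVars i Γ

tgtVars : ℕ → Ctx n → Subset n
tgtVars i ∅ = []
tgtVars i (∅ ▹ A) = true ∷ []
tgtVars i (Γ ▹ A ▹ B) =
  if suc i ≤ᵇ dimTy A then false ∷ false ∷ tgtVars i Γ
  else if dimTy A ≡ᵇ i then false ∷ true ∷ dropLast (tgtVars i Γ)
  else true ∷ true ∷ tgtVars i Γ

-- ∂⁻Γ = ∂⁻_{dim Γ - 1} Γ,  ∂⁺Γ = ∂⁺_{dim Γ - 1} Γ  (only used when dim Γ ≥ 1)
∂⁻Vars : Ctx n → Subset n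
∂⁻Vars Γ = srcVars (dimCtx Γ Data.Nat.∸ 1) Γ

∂⁺Vars : Ctx n → Subset n
∂⁺Vars Γ = tgtVars (dimCtx Γ Data.Nat.∸ 1) Γ

data _⊢ps_∶_ : Ctx n → Fin n → Ty n → Set where
  pss : (∅ ▹ ⋆) ⊢ps zero ∶ ⋆
  pse : {Γ : Ctx n} {x : Fin n} {A : Ty n} →
        Γ ⊢ps x ∶ A →
        (Γ ▹ A ▹ Hom (wkTy A) (var (suc x)) (var zero))
          ⊢ps zero ∶ wkTy (Hom (wkTy A) (var (suc x)) (var zero))
  psd : {Γ : Ctx n} {f y : Fin n} {A : Ty n} {t : Tm n} →
        Γ ⊢ps f ∶ Hom A t (var y) → Γ ⊢ps y ∶ A

data _⊢ps (Γ : Ctx n) : Set where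
  ps : {x : Fin n} → Γ ⊢ps x ∶ ⋆ → Γ ⊢ps

record OpCond (Γ : Ctx n) (B : Ty n) (t u : Tm n) : Set where
  field
    dim≥1 : 1 ≤ dimCtx Γ
    src   : varsTm t ∪ varsTy B ≡ ∂⁻Vars Γ
    tgt   : varsTm u ∪ varsTy B ≡ ∂⁺Vars Γ

record CohCond (Γ : Ctx n) (B : Ty n) (t u : Tm n) : Set where
  field
    src : varsTm t ∪ varsTy B ≡ ⊤
    tgt : varsTm u ∪ varsTy B ≡ ⊤

-- CaTT typing rules  (CaTT has no definitional equality beyond syntax)

data ⊢_       : Ctx n → Set
data _⊢ty_    : Ctx n → Ty n → Set
data _⊢_∶_    : Ctx n → Tm n → Ty n → Set
data _⊢ₛ_∶_   : Ctx m → Sub m n → Ctx n → Set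

data ⊢_ where
  c∅ : ⊢ ∅
  c▹ : {Γ : Ctx n} {A : Ty n} → Γ ⊢ty A → ⊢ (Γ ▹ A)

data _⊢ty_ where
  t⋆   : {Γ : Ctx n} → ⊢ Γ → Γ ⊢ty ⋆
  tHom : {Γ : Ctx n} {A : Ty n} {t u : Tm n} →
         Γ ⊢ t ∶ A → Γ ⊢ u ∶ A → Γ ⊢ty Hom A t u

data _⊢_∶_ where
  tvar : {Γ : Ctx n} {i : Fin n} → ⊢ Γ → Γ ⊢ var i ∶ ctxTy Γ i
  top  : {Δ : Ctx m} {Γ : Ctx k} {B : Ty k} {t u : Tm k} {γ : Sub m k} →
         Γ ⊢ps → Γ ⊢ty Hom B t u → OpCond Γ B t u → Δ ⊢ₛ γ ∶ Γ →
         Δ ⊢ op Γ (Hom B t u) γ ∶ (Hom B t u [ γ ]Ty)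
  tcoh : {Δ : Ctx m} {Γ : Ctx k} {B : Ty k} {t u : Tm k} {γ : Sub m k} →
         Γ ⊢ps → Γ ⊢ty Hom B t u → CohCond Γ B t u → Δ ⊢ₛ γ ∶ Γ →
         Δ ⊢ coh Γ (Hom B t u) γ ∶ (Hom B t u [ γ ]Ty)

data _⊢ₛ_∶_ where
  s⟨⟩ : {Δ : Ctx m} → ⊢ Δ → Δ ⊢ₛ ⟨⟩ ∶ ∅
  s,  : {Δ : Ctx m} {Γ : Ctx n} {γ : Sub m n} {A : Ty n} {t : Tm m} →
        Δ ⊢ₛ γ ∶ Γ → Γ ⊢ty A → Δ ⊢ t ∶ (A [ γ ]Ty) → Δ ⊢ₛ (γ ,ₛ t) ∶ (Γ ▹ A)

data MCtx : ℕ → Set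
data MTy  : ℕ → Set
data MTm  : ℕ → Set
data MSub : ℕ → ℕ → Set

data MCtx where
  ∅ᴹ   : MCtx 0
  _▹ᴹ_ : MCtx n → MTy n → MCtx (suc n)

data MTy where
  𝟙    : MTy n
  MHom : MTy n → MTm n → MTm n → MTy n

data MTm where
  ⟨⟩ᴹ  : MTm n
  mvar : Fin n → MTm n
  mop  : Ctx k → Ty k → MSub n k → MTm n
  mcoh : Ctx k → Ty k → MSub n k → MTm n

data MSub where
  ⟨⟩ₘ  : MSub m 0
  _,ₘ_ : MSub m n → MTm m → MSub m (suc n)

mrenTy  : (Fin n → Fin m) → MTy n → MTy m
mrenTm  : (Fin n → Fin m) → MTm n → MTm m
mrenSub : (Fin n → Fin m) → MSub n k → MSub m k
mrenTy ρ 𝟙 = 𝟙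
mrenTy ρ (MHom A t u) = MHom (mrenTy ρ A) (mrenTm ρ t) (mrenTm ρ u)
mrenTm ρ ⟨⟩ᴹ = ⟨⟩ᴹ
mrenTm ρ (mvar i) = mvar (ρ i)
mrenTm ρ (mop Γ A γ) = mop Γ A (mrenSub ρ γ)
mrenTm ρ (mcoh Γ A γ) = mcoh Γ A (mrenSub ρ γ)
mrenSub ρ ⟨⟩ₘ = ⟨⟩ₘ
mrenSub ρ (γ ,ₘ t) = mrenSub ρ γ ,ₘ mrenTm ρ t

mwkTy : MTy n → MTy (suc n)
mwkTy = mrenTy suc

mwkSub : MSub n k → MSub (suc n) k
mwkSub = mrenSub suc

mctxTy : MCtx n → Fin n → MTy n
mctxTy (Γ ▹ᴹ A) zero    = mwkTy A
mctxTy (Γ ▹ᴹ A) (suc i) = mwkTy (mctxTy Γ i)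

mlookupSub : MSub m n → Fin n → MTm m
mlookupSub (γ ,ₘ t) zero    = t
mlookupSub (γ ,ₘ t) (suc i) = mlookupSub γ i

_[_]MTy : MTy n → MSub m n → MTy m
_[_]MTm : MTm n → MSub m n → MTm m
_∘ₘ_    : MSub k n → MSub m k → MSub m n
𝟙 [ γ ]MTy = 𝟙
MHom A t u [ γ ]MTy = MHom (A [ γ ]MTy) (t [ γ ]MTm) (u [ γ ]MTm)
⟨⟩ᴹ [ γ ]MTm = ⟨⟩ᴹ
mvar i [ γ ]MTm = mlookupSub γ i
mop Γ A δ [ γ ]MTm = mop Γ A (δ ∘ₘ γ)
mcoh Γ A δ [ γ ]MTm = mcoh Γ A (δ ∘ₘ γ)
⟨⟩ₘ ∘ₘ δ = ⟨⟩ₘ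
(γ ,ₘ t) ∘ₘ δ = (γ ∘ₘ δ) ,ₘ (t [ δ ]MTm)

midSub : (n : ℕ) → MSub n n
midSub zero    = ⟨⟩ₘ
midSub (suc n) = mwkSub (midSub n) ,ₘ mvar zero

mpSub : (n : ℕ) → MSub (suc n) n
mpSub n = mwkSub (midSub n)

mqTm : (n : ℕ) → MTm (suc n)
mqTm n = mvar zero

DCtx : Ctx n → MCtx n
DTy  : Ty n → MTy n
DTm  : Tm n → MTm n
DSub : Sub m n → MSub m n
DCtx ∅ = ∅ᴹ
DCtx (Γ ▹ A) = DCtx Γ ▹ᴹ DTy A
DTy ⋆ = 𝟙
DTy (Hom A t u) = MHom (DTy A) (DTm t) (DTm u)
DTm (var i) = mvar i
DTm (op Γ A γ) = mop Γ A (DSub γ)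
DTm (coh Γ A γ) = mcoh Γ A (DSub γ)
DSub ⟨⟩ = ⟨⟩ₘ
DSub (γ ,ₛ t) = DSub γ ,ₘ DTm t

data ⊢ᴹ_          : MCtx n → Set
data _⊢ᴹty_       : MCtx n → MTy n → Set
data _⊢ᴹ_∶_       : MCtx n → MTm n → MTy n → Set
data _⊢ᴹₛ_∶_      : MCtx m → MSub m n → MCtx n → Set
data ⊢ᴹ_≃ctx_        : MCtx n → MCtx n → Set
data _⊢ᴹ_≃ty_     : MCtx n → MTy n → MTy n → Set
data _⊢ᴹ_≃_∶_     : MCtx n → MTm n → MTm n → MTy n → Set
data _⊢ᴹₛ_≃_∶_    : MCtx m → MSub m n → MSub m n → MCtx n → Set

data ⊢ᴹ_ where
  mc∅ : ⊢ᴹ ∅ᴹ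
  mc▹ : {Γ : MCtx n} {A : MTy n} → Γ ⊢ᴹty A → ⊢ᴹ (Γ ▹ᴹ A)

data _⊢ᴹty_ where
  m𝟙   : {Γ : MCtx n} → ⊢ᴹ Γ → Γ ⊢ᴹty 𝟙
  mHom : {Γ : MCtx n} {A : MTy n} {t u : MTm n} →
         Γ ⊢ᴹ t ∶ A → Γ ⊢ᴹ u ∶ A → Γ ⊢ᴹty MHom A t u

data _⊢ᴹ_∶_ where
  munit : {Γ : MCtx n} → ⊢ᴹ Γ → Γ ⊢ᴹ ⟨⟩ᴹ ∶ 𝟙
  mtvar : {Γ : MCtx n} {i : Fin n} → ⊢ᴹ Γ → Γ ⊢ᴹ mvar i ∶ mctxTy Γ i
  mtop  : {Δ : MCtx m} {Γ : Ctx k} {B : Ty k} {t u : Tm k} {γ : MSub m k} →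
          Γ ⊢ps → Γ ⊢ty Hom B t u → OpCond Γ B t u → Δ ⊢ᴹₛ γ ∶ DCtx Γ →
          Δ ⊢ᴹ mop Γ (Hom B t u) γ ∶ (DTy (Hom B t u) [ γ ]MTy)
  mtcoh : {Δ : MCtx m} {Γ : Ctx k} {B : Ty k} {t u : Tm k} {γ : MSub m k} →
          Γ ⊢ps → Γ ⊢ty Hom B t u → CohCond Γ B t u → Δ ⊢ᴹₛ γ ∶ DCtx Γ →
          Δ ⊢ᴹ mcoh Γ (Hom B t u) γ ∶ (DTy (Hom B t u) [ γ ]MTy)
  mconv : {Γ : MCtx n} {t : MTm n} {A B : MTy n} →
          Γ ⊢ᴹ t ∶ A → Γ ⊢ᴹ A ≃ty B → Γ ⊢ᴹ t ∶ B

data _⊢ᴹₛ_∶_ where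
  ms⟨⟩ : {Δ : MCtx m} → ⊢ᴹ Δ → Δ ⊢ᴹₛ ⟨⟩ₘ ∶ ∅ᴹ
  ms,  : {Δ : MCtx m} {Γ : MCtx n} {γ : MSub m n} {A : MTy n} {t : MTm m} →
         Δ ⊢ᴹₛ γ ∶ Γ → Γ ⊢ᴹty A → Δ ⊢ᴹ t ∶ (A [ γ ]MTy) →
         Δ ⊢ᴹₛ (γ ,ₘ t) ∶ (Γ ▹ᴹ A)

data ⊢ᴹ_≃ctx_ where
  mce∅ : ⊢ᴹ ∅ᴹ ≃ctx ∅ᴹ
  mce▹ : {Γ Γ' : MCtx n} {A A' : MTy n} →
         ⊢ᴹ Γ ≃ctx Γ' → Γ ⊢ᴹ A ≃ty A' → ⊢ᴹ (Γ ▹ᴹ A) ≃ctx (Γ' ▹ᴹ A')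

data _⊢ᴹ_≃ty_ where
  ety-refl  : {Γ : MCtx n} {A : MTy n} → Γ ⊢ᴹty A → Γ ⊢ᴹ A ≃ty A
  ety-sym   : {Γ : MCtx n} {A B : MTy n} → Γ ⊢ᴹ A ≃ty B → Γ ⊢ᴹ B ≃ty A
  ety-trans : {Γ : MCtx n} {A B C : MTy n} →
              Γ ⊢ᴹ A ≃ty B → Γ ⊢ᴹ B ≃ty C → Γ ⊢ᴹ A ≃ty C
  ety-Hom   : {Γ : MCtx n} {A A' : MTy n} {t t' u u' : MTm n} →
              Γ ⊢ᴹ A ≃ty A' → Γ ⊢ᴹ t ≃ t' ∶ A → Γ ⊢ᴹ u ≃ u' ∶ A →
              Γ ⊢ᴹ MHom A t u ≃ty MHom A' t' u'

data _⊢ᴹ_≃_∶_ where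
  etm-refl  : {Γ : MCtx n} {t : MTm n} {A : MTy n} → Γ ⊢ᴹ t ∶ A → Γ ⊢ᴹ t ≃ t ∶ A
  etm-sym   : {Γ : MCtx n} {t u : MTm n} {A : MTy n} →
              Γ ⊢ᴹ t ≃ u ∶ A → Γ ⊢ᴹ u ≃ t ∶ A
  etm-trans : {Γ : MCtx n} {t u v : MTm n} {A : MTy n} →
              Γ ⊢ᴹ t ≃ u ∶ A → Γ ⊢ᴹ u ≃ v ∶ A → Γ ⊢ᴹ t ≃ v ∶ A
  etm-conv  : {Γ : MCtx n} {t u : MTm n} {A B : MTy n} →
              Γ ⊢ᴹ t ≃ u ∶ A → Γ ⊢ᴹ A ≃ty B → Γ ⊢ᴹ t ≃ u ∶ B
  etm-η     : {Γ : MCtx n} {t : MTm n} → Γ ⊢ᴹ t ∶ 𝟙 → Γ ⊢ᴹ t ≃ ⟨⟩ᴹ ∶ 𝟙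
  etm-op    : {Δ : MCtx m} {Γ : Ctx k} {B : Ty k} {t u : Tm k} {γ δ : MSub m k} →
              Γ ⊢ps → Γ ⊢ty Hom B t u → OpCond Γ B t u → Δ ⊢ᴹₛ γ ≃ δ ∶ DCtx Γ →
              Δ ⊢ᴹ mop Γ (Hom B t u) γ ≃ mop Γ (Hom B t u) δ
                 ∶ (DTy (Hom B t u) [ γ ]MTy)
  etm-coh   : {Δ : MCtx m} {Γ : Ctx k} {B : Ty k} {t u : Tm k} {γ δ : MSub m k} →
              Γ ⊢ps → Γ ⊢ty Hom B t u → CohCond Γ B t u → Δ ⊢ᴹₛ γ ≃ δ ∶ DCtx Γ →
              Δ ⊢ᴹ mcoh Γ (Hom B t u) γ ≃ mcoh Γ (Hom B t u) δ
                 ∶ (DTy (Hom B t u) [ γ ]MTy)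

data _⊢ᴹₛ_≃_∶_ where
  mse⟨⟩ : {Δ : MCtx m} → ⊢ᴹ Δ → Δ ⊢ᴹₛ ⟨⟩ₘ ≃ ⟨⟩ₘ ∶ ∅ᴹ
  mse,  : {Δ : MCtx m} {Γ : MCtx n} {γ δ : MSub m n} {A : MTy n} {t u : MTm m} →
          Δ ⊢ᴹₛ γ ≃ δ ∶ Γ → Γ ⊢ᴹty A → Δ ⊢ᴹ t ≃ u ∶ (A [ γ ]MTy) →
          Δ ⊢ᴹₛ (γ ,ₘ t) ≃ (δ ,ₘ u) ∶ (Γ ▹ᴹ A)

-- In Syn(T): objects are derivable contexts, morphisms Δ → Γ derivable
-- substitutions, Ty(Γ) derivable types, Tm(Γ,A) derivable terms, all up to
-- definitional equality (for CaTT this is syntactic equality, so D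
-- trivially respects it).  Equalities in Syn(MCaTT) are MCaTT
-- definitional equalities.  A CwF morphism is a functor (well defined on
-- objects/morphisms, preserving identities and composition), with actions
-- on types and terms commuting with substitution, preserving the terminal
-- object and context comprehension (Γ.A, p, q, ⟨γ,t⟩) on the nose.

record DesuspensionIsCwFMorphism : Set where
  field
    D-ctx : {Γ : Ctx n} → ⊢ Γ → ⊢ᴹ DCtx Γ
    D-ty  : {Γ : Ctx n} {A : Ty n} → Γ ⊢ty A → DCtx Γ ⊢ᴹty DTy A
    D-tm  : {Γ : Ctx n} {t : Tm n} {A : Ty n} →
            Γ ⊢ t ∶ A → DCtx Γ ⊢ᴹ DTm t ∶ DTy A
    D-sub : {Δ : Ctx m} {Γ : Ctx n} {γ : Sub m n} →
            Δ ⊢ₛ γ ∶ Γ → DCtx Δ ⊢ᴹₛ DSub γ ∶ DCtx Γ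
    D-id   : {Γ : Ctx n} → ⊢ Γ →
             DCtx Γ ⊢ᴹₛ DSub (idSub n) ≃ midSub n ∶ DCtx Γ
    D-comp : {Θ : Ctx k} {Δ : Ctx m} {Γ : Ctx n} {δ : Sub k m} {γ : Sub m n} →
             Θ ⊢ₛ δ ∶ Δ → Δ ⊢ₛ γ ∶ Γ →
             DCtx Θ ⊢ᴹₛ DSub (γ ∘ₛ δ) ≃ (DSub γ ∘ₘ DSub δ) ∶ DCtx Γ
    D-ty-sub : {Δ : Ctx m} {Γ : Ctx n} {A : Ty n} {γ : Sub m n} →
               Γ ⊢ty A → Δ ⊢ₛ γ ∶ Γ →
               DCtx Δ ⊢ᴹ DTy (A [ γ ]Ty) ≃ty (DTy A [ DSub γ ]MTy)
    D-tm-sub : {Δ : Ctx m} {Γ : Ctx n} {t : Tm n} {A : Ty n} {γ : Sub m n} →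
               Γ ⊢ t ∶ A → Δ ⊢ₛ γ ∶ Γ →
               DCtx Δ ⊢ᴹ DTm (t [ γ ]Tm) ≃ (DTm t [ DSub γ ]MTm) ∶ DTy (A [ γ ]Ty)
    D-empty : ⊢ᴹ DCtx ∅ ≃ctx ∅ᴹ
    D-ext  : {Γ : Ctx n} {A : Ty n} → Γ ⊢ty A →
             ⊢ᴹ DCtx (Γ ▹ A) ≃ctx (DCtx Γ ▹ᴹ DTy A)
    D-p    : {Γ : Ctx n} {A : Ty n} → Γ ⊢ty A →
             DCtx (Γ ▹ A) ⊢ᴹₛ DSub (pSub n) ≃ mpSub n ∶ DCtx Γ
    D-q    : {Γ : Ctx n} {A : Ty n} → Γ ⊢ty A →
             DCtx (Γ ▹ A) ⊢ᴹ DTm (qTm n) ≃ mqTm n ∶ DTy (A [ pSub n ]Ty)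
    D-pair : {Δ : Ctx m} {Γ : Ctx n} {A : Ty n} {γ : Sub m n} {t : Tm m} →
             Δ ⊢ₛ γ ∶ Γ → Γ ⊢ty A → Δ ⊢ t ∶ (A [ γ ]Ty) →
             DCtx Δ ⊢ᴹₛ DSub (γ ,ₛ t) ≃ (DSub γ ,ₘ DTm t) ∶ DCtx (Γ ▹ A)

{-# OPTIONS --safe #-}
-- The desuspension is a structural translation, so it commutes on the nose
-- with renaming, substitution and composition and sends the identity
-- substitution to the identity. Every equation required of a CwF morphism
-- is therefore a syntactic identity between MCaTT expressions that are
-- derivable because D preserves derivability (the typing rules of mop and
-- mcoh mirror those of op and coh) and CaTT is closed under substitution;
-- reflexivity of definitional equality then proves it.
module Submission where

open import Defs
open import Data.Nat using (ℕ; zero; suc)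
open import Data.Fin using (Fin; zero; suc)
open import Relation.Binary.PropositionalEquality

private
  variable
    k l m n : ℕ

cong₃ : {A B C D : Set} (f : A → B → C → D) {a a' : A} {b b' : B} {c c' : C} →
        a ≡ a' → b ≡ b' → c ≡ c' → f a b c ≡ f a' b' c'
cong₃ f refl refl refl = refl

renTm-lookupSub : (ρ : Fin m → Fin l) (γ : Sub m n) (i : Fin n) →
                  renTm ρ (lookupSub γ i) ≡ lookupSub (renSub ρ γ) i
renTm-lookupSub ρ (γ ,ₛ t) zero    = refl
renTm-lookupSub ρ (γ ,ₛ t) (suc i) = renTm-lookupSub ρ γ i

renTy-[]Ty  : (ρ : Fin m → Fin l) (A : Ty n) (γ : Sub m n) →
              renTy ρ (A [ γ ]Ty) ≡ A [ renSub ρ γ ]Ty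
renTm-[]Tm  : (ρ : Fin m → Fin l) (t : Tm n) (γ : Sub m n) →
              renTm ρ (t [ γ ]Tm) ≡ t [ renSub ρ γ ]Tm
renSub-∘ₛ   : (ρ : Fin m → Fin l) (δ : Sub n k) (γ : Sub m n) →
              renSub ρ (δ ∘ₛ γ) ≡ δ ∘ₛ renSub ρ γ
renTy-[]Ty ρ ⋆ γ           = refl
renTy-[]Ty ρ (Hom A t u) γ = cong₃ Hom (renTy-[]Ty ρ A γ) (renTm-[]Tm ρ t γ) (renTm-[]Tm ρ u γ)
renTm-[]Tm ρ (var i) γ     = renTm-lookupSub ρ γ i
renTm-[]Tm ρ (op Γ A δ) γ  = cong (op Γ A) (renSub-∘ₛ ρ δ γ)
renTm-[]Tm ρ (coh Γ A δ) γ = cong (coh Γ A) (renSub-∘ₛ ρ δ γ)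
renSub-∘ₛ ρ ⟨⟩ γ       = refl
renSub-∘ₛ ρ (δ ,ₛ t) γ = cong₂ _,ₛ_ (renSub-∘ₛ ρ δ γ) (renTm-[]Tm ρ t γ)

module _ (ρ : Fin n → Fin k) (σ : Sub m k) (τ : Sub m n)
         (σ∘ρ≗τ : ∀ i → lookupSub σ (ρ i) ≡ lookupSub τ i) where

  []Ty-renTy : (A : Ty n) → renTy ρ A [ σ ]Ty ≡ A [ τ ]Ty
  []Tm-renTm : (t : Tm n) → renTm ρ t [ σ ]Tm ≡ t [ τ ]Tm
  ∘ₛ-renSub  : (δ : Sub n l) → renSub ρ δ ∘ₛ σ ≡ δ ∘ₛ τ
  []Ty-renTy ⋆           = refl
  []Ty-renTy (Hom A t u) = cong₃ Hom ([]Ty-renTy A) ([]Tm-renTm t) ([]Tm-renTm u)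
  []Tm-renTm (var i)     = σ∘ρ≗τ i
  []Tm-renTm (op Γ A δ)  = cong (op Γ A) (∘ₛ-renSub δ)
  []Tm-renTm (coh Γ A δ) = cong (coh Γ A) (∘ₛ-renSub δ)
  ∘ₛ-renSub ⟨⟩       = refl
  ∘ₛ-renSub (δ ,ₛ t) = cong₂ _,ₛ_ (∘ₛ-renSub δ) ([]Tm-renTm t)

wkTy-[,ₛ] : (A : Ty n) (γ : Sub m n) (t : Tm m) → wkTy A [ γ ,ₛ t ]Ty ≡ A [ γ ]Ty
wkTy-[,ₛ] A γ t = []Ty-renTy suc (γ ,ₛ t) γ (λ _ → refl) A

lookupSub-idSub : (n : ℕ) (i : Fin n) → lookupSub (idSub n) i ≡ var i
lookupSub-idSub (suc n) zero    = refl
lookupSub-idSub (suc n) (suc i) = begin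
  lookupSub (wkSub (idSub n)) i  ≡⟨ renTm-lookupSub suc (idSub n) i ⟨
  renTm suc (lookupSub (idSub n) i) ≡⟨ cong (renTm suc) (lookupSub-idSub n i) ⟩
  var (suc i)                    ∎
  where open ≡-Reasoning

[idSub]Ty     : (A : Ty n) → A [ idSub n ]Ty ≡ A
[idSub]Tm     : (t : Tm n) → t [ idSub n ]Tm ≡ t
∘ₛ-identityʳ : (δ : Sub n k) → δ ∘ₛ idSub n ≡ δ
[idSub]Ty ⋆           = refl
[idSub]Ty (Hom A t u) = cong₃ Hom ([idSub]Ty A) ([idSub]Tm t) ([idSub]Tm u)
[idSub]Tm {n} (var i) = lookupSub-idSub n i
[idSub]Tm (op Γ A δ)  = cong (op Γ A) (∘ₛ-identityʳ δ)
[idSub]Tm (coh Γ A δ) = cong (coh Γ A) (∘ₛ-identityʳ δ)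
∘ₛ-identityʳ ⟨⟩       = refl
∘ₛ-identityʳ (δ ,ₛ t) = cong₂ _,ₛ_ (∘ₛ-identityʳ δ) ([idSub]Tm t)

wkTy≡[pSub]Ty : (A : Ty n) → wkTy A ≡ A [ pSub n ]Ty
wkTy≡[pSub]Ty {n} A = begin
  wkTy A                       ≡⟨ cong wkTy ([idSub]Ty A) ⟨
  renTy suc (A [ idSub n ]Ty)  ≡⟨ renTy-[]Ty suc A (idSub n) ⟩
  A [ pSub n ]Ty               ∎
  where open ≡-Reasoning

lookupSub-∘ₛ : (γ : Sub k n) (δ : Sub m k) (i : Fin n) →
               lookupSub (γ ∘ₛ δ) i ≡ lookupSub γ i [ δ ]Tm
lookupSub-∘ₛ (γ ,ₛ t) δ zero    = refl
lookupSub-∘ₛ (γ ,ₛ t) δ (suc i) = lookupSub-∘ₛ γ δ i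

[]Ty-∘ₛ  : (A : Ty n) (γ : Sub k n) (δ : Sub m k) → A [ γ ]Ty [ δ ]Ty ≡ A [ γ ∘ₛ δ ]Ty
[]Tm-∘ₛ  : (t : Tm n) (γ : Sub k n) (δ : Sub m k) → t [ γ ]Tm [ δ ]Tm ≡ t [ γ ∘ₛ δ ]Tm
∘ₛ-assoc : (θ : Sub n l) (γ : Sub k n) (δ : Sub m k) → (θ ∘ₛ γ) ∘ₛ δ ≡ θ ∘ₛ (γ ∘ₛ δ)
[]Ty-∘ₛ ⋆ γ δ           = refl
[]Ty-∘ₛ (Hom A t u) γ δ = cong₃ Hom ([]Ty-∘ₛ A γ δ) ([]Tm-∘ₛ t γ δ) ([]Tm-∘ₛ u γ δ)
[]Tm-∘ₛ (var i) γ δ     = sym (lookupSub-∘ₛ γ δ i)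
[]Tm-∘ₛ (op Γ A θ) γ δ  = cong (op Γ A) (∘ₛ-assoc θ γ δ)
[]Tm-∘ₛ (coh Γ A θ) γ δ = cong (coh Γ A) (∘ₛ-assoc θ γ δ)
∘ₛ-assoc ⟨⟩ γ δ       = refl
∘ₛ-assoc (θ ,ₛ t) γ δ = cong₂ _,ₛ_ (∘ₛ-assoc θ γ δ) ([]Tm-∘ₛ t γ δ)

DTy-renTy   : (ρ : Fin n → Fin m) (A : Ty n) → DTy (renTy ρ A) ≡ mrenTy ρ (DTy A)
DTm-renTm   : (ρ : Fin n → Fin m) (t : Tm n) → DTm (renTm ρ t) ≡ mrenTm ρ (DTm t)
DSub-renSub : (ρ : Fin n → Fin m) (γ : Sub n k) → DSub (renSub ρ γ) ≡ mrenSub ρ (DSub γ)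
DTy-renTy ρ ⋆           = refl
DTy-renTy ρ (Hom A t u) = cong₃ MHom (DTy-renTy ρ A) (DTm-renTm ρ t) (DTm-renTm ρ u)
DTm-renTm ρ (var i)     = refl
DTm-renTm ρ (op Γ A γ)  = cong (mop Γ A) (DSub-renSub ρ γ)
DTm-renTm ρ (coh Γ A γ) = cong (mcoh Γ A) (DSub-renSub ρ γ)
DSub-renSub ρ ⟨⟩       = refl
DSub-renSub ρ (γ ,ₛ t) = cong₂ _,ₘ_ (DSub-renSub ρ γ) (DTm-renTm ρ t)

DTm-lookupSub : (γ : Sub m n) (i : Fin n) → DTm (lookupSub γ i) ≡ mlookupSub (DSub γ) i
DTm-lookupSub (γ ,ₛ t) zero    = refl
DTm-lookupSub (γ ,ₛ t) (suc i) = DTm-lookupSub γ i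

DTy-[]Ty : (A : Ty n) (γ : Sub m n) → DTy (A [ γ ]Ty) ≡ DTy A [ DSub γ ]MTy
DTm-[]Tm : (t : Tm n) (γ : Sub m n) → DTm (t [ γ ]Tm) ≡ DTm t [ DSub γ ]MTm
DSub-∘ₛ  : (δ : Sub n k) (γ : Sub m n) → DSub (δ ∘ₛ γ) ≡ DSub δ ∘ₘ DSub γ
DTy-[]Ty ⋆ γ           = refl
DTy-[]Ty (Hom A t u) γ = cong₃ MHom (DTy-[]Ty A γ) (DTm-[]Tm t γ) (DTm-[]Tm u γ)
DTm-[]Tm (var i) γ     = DTm-lookupSub γ i
DTm-[]Tm (op Γ A δ) γ  = cong (mop Γ A) (DSub-∘ₛ δ γ)
DTm-[]Tm (coh Γ A δ) γ = cong (mcoh Γ A) (DSub-∘ₛ δ γ)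
DSub-∘ₛ ⟨⟩ γ       = refl
DSub-∘ₛ (δ ,ₛ t) γ = cong₂ _,ₘ_ (DSub-∘ₛ δ γ) (DTm-[]Tm t γ)

DSub-wkSub : (γ : Sub n k) → DSub (wkSub γ) ≡ mwkSub (DSub γ)
DSub-wkSub = DSub-renSub suc

DSub-idSub : (n : ℕ) → DSub (idSub n) ≡ midSub n
DSub-pSub  : (n : ℕ) → DSub (pSub n) ≡ mpSub n
DSub-idSub zero    = refl
DSub-idSub (suc n) = cong (_,ₘ mvar zero) (DSub-pSub n)
DSub-pSub n = trans (DSub-wkSub (idSub n)) (cong mwkSub (DSub-idSub n))

DTy-ctxTy : (Γ : Ctx n) (i : Fin n) → DTy (ctxTy Γ i) ≡ mctxTy (DCtx Γ) i
DTy-ctxTy (Γ ▹ A) zero    = DTy-renTy suc A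
DTy-ctxTy (Γ ▹ A) (suc i) = trans (DTy-renTy suc (ctxTy Γ i)) (cong mwkTy (DTy-ctxTy Γ i))

⊢-retype : {Γ : Ctx n} {t : Tm n} {A B : Ty n} → A ≡ B → Γ ⊢ t ∶ A → Γ ⊢ t ∶ B
⊢-retype refl ⊢t = ⊢t

⊢ty⇒⊢ : {Γ : Ctx n} {A : Ty n} → Γ ⊢ty A → ⊢ Γ
⊢tm⇒⊢ : {Γ : Ctx n} {t : Tm n} {A : Ty n} → Γ ⊢ t ∶ A → ⊢ Γ
⊢ₛ⇒⊢  : {Δ : Ctx m} {Γ : Ctx n} {γ : Sub m n} → Δ ⊢ₛ γ ∶ Γ → ⊢ Δ
⊢ty⇒⊢ (t⋆ ⊢Γ)      = ⊢Γ
⊢ty⇒⊢ (tHom ⊢t _)  = ⊢tm⇒⊢ ⊢t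
⊢tm⇒⊢ (tvar ⊢Γ)       = ⊢Γ
⊢tm⇒⊢ (top _ _ _ ⊢γ)  = ⊢ₛ⇒⊢ ⊢γ
⊢tm⇒⊢ (tcoh _ _ _ ⊢γ) = ⊢ₛ⇒⊢ ⊢γ
⊢ₛ⇒⊢ (s⟨⟩ ⊢Δ)    = ⊢Δ
⊢ₛ⇒⊢ (s, ⊢γ _ _) = ⊢ₛ⇒⊢ ⊢γ

wk-⊢tm : {Γ : Ctx n} {B : Ty n} {t : Tm n} {A : Ty n} → ⊢ (Γ ▹ B) →
         Γ ⊢ t ∶ A → (Γ ▹ B) ⊢ renTm suc t ∶ wkTy A
wk-⊢ₛ  : {Δ : Ctx m} {B : Ty m} {Γ : Ctx n} {γ : Sub m n} → ⊢ (Δ ▹ B) →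
         Δ ⊢ₛ γ ∶ Γ → (Δ ▹ B) ⊢ₛ wkSub γ ∶ Γ
wk-⊢tm ⊢ΓB (tvar _) = tvar ⊢ΓB
wk-⊢tm ⊢ΓB (top {B = B} {t} {u} {γ} Γps ⊢A cd ⊢γ) =
  ⊢-retype (sym (renTy-[]Ty suc (Hom B t u) γ)) (top Γps ⊢A cd (wk-⊢ₛ ⊢ΓB ⊢γ))
wk-⊢tm ⊢ΓB (tcoh {B = B} {t} {u} {γ} Γps ⊢A cd ⊢γ) =
  ⊢-retype (sym (renTy-[]Ty suc (Hom B t u) γ)) (tcoh Γps ⊢A cd (wk-⊢ₛ ⊢ΓB ⊢γ))
wk-⊢ₛ ⊢ΔB (s⟨⟩ _) = s⟨⟩ ⊢ΔB
wk-⊢ₛ ⊢ΔB (s, {γ = γ} {A} ⊢γ ⊢A ⊢t) =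
  s, (wk-⊢ₛ ⊢ΔB ⊢γ) ⊢A (⊢-retype (renTy-[]Ty suc A γ) (wk-⊢tm ⊢ΔB ⊢t))

idSub-⊢ₛ : {Γ : Ctx n} → ⊢ Γ → Γ ⊢ₛ idSub n ∶ Γ
pSub-⊢ₛ  : {Γ : Ctx n} {A : Ty n} → Γ ⊢ty A → (Γ ▹ A) ⊢ₛ pSub n ∶ Γ
idSub-⊢ₛ c∅ = s⟨⟩ c∅
idSub-⊢ₛ {Γ = Γ ▹ A} (c▹ ⊢A) =
  s, (pSub-⊢ₛ ⊢A) ⊢A (⊢-retype (wkTy≡[pSub]Ty A) (tvar (c▹ ⊢A)))
pSub-⊢ₛ ⊢A = wk-⊢ₛ (c▹ ⊢A) (idSub-⊢ₛ (⊢ty⇒⊢ ⊢A))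

lookupSub-⊢ : {Δ : Ctx m} {Γ : Ctx n} {γ : Sub m n} → Δ ⊢ₛ γ ∶ Γ →
              (i : Fin n) → Δ ⊢ lookupSub γ i ∶ (ctxTy Γ i [ γ ]Ty)
lookupSub-⊢ (s, {γ = γ} {A} {t} _ _ ⊢t) zero =
  ⊢-retype (sym (wkTy-[,ₛ] A γ t)) ⊢t
lookupSub-⊢ {Γ = Γ ▹ _} (s, {γ = γ} {t = t} ⊢γ _ _) (suc i) =
  ⊢-retype (sym (wkTy-[,ₛ] (ctxTy Γ i) γ t)) (lookupSub-⊢ ⊢γ i)

[]-⊢ty : {Δ : Ctx m} {Γ : Ctx n} {A : Ty n} {δ : Sub m n} →
         Γ ⊢ty A → Δ ⊢ₛ δ ∶ Γ → Δ ⊢ty (A [ δ ]Ty)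
[]-⊢tm : {Δ : Ctx m} {Γ : Ctx n} {t : Tm n} {A : Ty n} {δ : Sub m n} →
         Γ ⊢ t ∶ A → Δ ⊢ₛ δ ∶ Γ → Δ ⊢ (t [ δ ]Tm) ∶ (A [ δ ]Ty)
∘ₛ-⊢ₛ  : {Θ : Ctx k} {Δ : Ctx m} {Γ : Ctx n} {δ : Sub k m} {γ : Sub m n} →
         Δ ⊢ₛ γ ∶ Γ → Θ ⊢ₛ δ ∶ Δ → Θ ⊢ₛ (γ ∘ₛ δ) ∶ Γ
[]-⊢ty (t⋆ _)       ⊢δ = t⋆ (⊢ₛ⇒⊢ ⊢δ)
[]-⊢ty (tHom ⊢t ⊢u) ⊢δ = tHom ([]-⊢tm ⊢t ⊢δ) ([]-⊢tm ⊢u ⊢δ)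
[]-⊢tm (tvar {i = i} _) ⊢δ = lookupSub-⊢ ⊢δ i
[]-⊢tm {δ = δ} (top {B = B} {t} {u} {γ} Γps ⊢A cd ⊢γ) ⊢δ =
  ⊢-retype (sym ([]Ty-∘ₛ (Hom B t u) γ δ)) (top Γps ⊢A cd (∘ₛ-⊢ₛ ⊢γ ⊢δ))
[]-⊢tm {δ = δ} (tcoh {B = B} {t} {u} {γ} Γps ⊢A cd ⊢γ) ⊢δ =
  ⊢-retype (sym ([]Ty-∘ₛ (Hom B t u) γ δ)) (tcoh Γps ⊢A cd (∘ₛ-⊢ₛ ⊢γ ⊢δ))
∘ₛ-⊢ₛ (s⟨⟩ _) ⊢δ = s⟨⟩ (⊢ₛ⇒⊢ ⊢δ)
∘ₛ-⊢ₛ {δ = δ} (s, {γ = γ} {A} ⊢γ ⊢A ⊢t) ⊢δ =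
  s, (∘ₛ-⊢ₛ ⊢γ ⊢δ) ⊢A (⊢-retype ([]Ty-∘ₛ A γ δ) ([]-⊢tm ⊢t ⊢δ))

⊢ᴹ-retype : {Γ : MCtx n} {t : MTm n} {A B : MTy n} → A ≡ B → Γ ⊢ᴹ t ∶ A → Γ ⊢ᴹ t ∶ B
⊢ᴹ-retype refl ⊢t = ⊢t

D-⊢   : {Γ : Ctx n} → ⊢ Γ → ⊢ᴹ DCtx Γ
D-⊢ty : {Γ : Ctx n} {A : Ty n} → Γ ⊢ty A → DCtx Γ ⊢ᴹty DTy A
D-⊢tm : {Γ : Ctx n} {t : Tm n} {A : Ty n} → Γ ⊢ t ∶ A → DCtx Γ ⊢ᴹ DTm t ∶ DTy A
D-⊢ₛ  : {Δ : Ctx m} {Γ : Ctx n} {γ : Sub m n} → Δ ⊢ₛ γ ∶ Γ → DCtx Δ ⊢ᴹₛ DSub γ ∶ DCtx Γ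
D-⊢ c∅       = mc∅
D-⊢ (c▹ ⊢A)  = mc▹ (D-⊢ty ⊢A)
D-⊢ty (t⋆ ⊢Γ)      = m𝟙 (D-⊢ ⊢Γ)
D-⊢ty (tHom ⊢t ⊢u) = mHom (D-⊢tm ⊢t) (D-⊢tm ⊢u)
D-⊢tm {Γ = Γ} (tvar {i = i} ⊢Γ) =
  ⊢ᴹ-retype (sym (DTy-ctxTy Γ i)) (mtvar (D-⊢ ⊢Γ))
D-⊢tm (top {B = B} {t} {u} {γ} Γps ⊢A cd ⊢γ) =
  ⊢ᴹ-retype (sym (DTy-[]Ty (Hom B t u) γ)) (mtop Γps ⊢A cd (D-⊢ₛ ⊢γ))
D-⊢tm (tcoh {B = B} {t} {u} {γ} Γps ⊢A cd ⊢γ) =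
  ⊢ᴹ-retype (sym (DTy-[]Ty (Hom B t u) γ)) (mtcoh Γps ⊢A cd (D-⊢ₛ ⊢γ))
D-⊢ₛ (s⟨⟩ ⊢Δ) = ms⟨⟩ (D-⊢ ⊢Δ)
D-⊢ₛ (s, {γ = γ} {A} ⊢γ ⊢A ⊢t) =
  ms, (D-⊢ₛ ⊢γ) (D-⊢ty ⊢A) (⊢ᴹ-retype (DTy-[]Ty A γ) (D-⊢tm ⊢t))

msub-refl : {Δ : MCtx m} {Γ : MCtx n} {γ : MSub m n} → Δ ⊢ᴹₛ γ ∶ Γ → Δ ⊢ᴹₛ γ ≃ γ ∶ Γ
msub-refl (ms⟨⟩ ⊢Δ)      = mse⟨⟩ ⊢Δ
msub-refl (ms, ⊢γ ⊢A ⊢t) = mse, (msub-refl ⊢γ) ⊢A (etm-refl ⊢t)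

msub-reflexive : {Δ : MCtx m} {Γ : MCtx n} {γ δ : MSub m n} →
                 γ ≡ δ → Δ ⊢ᴹₛ γ ∶ Γ → Δ ⊢ᴹₛ γ ≃ δ ∶ Γ
msub-reflexive refl = msub-refl

ety-reflexive : {Γ : MCtx n} {A B : MTy n} → A ≡ B → Γ ⊢ᴹty A → Γ ⊢ᴹ A ≃ty B
ety-reflexive refl = ety-refl

etm-reflexive : {Γ : MCtx n} {t u : MTm n} {A : MTy n} →
                t ≡ u → Γ ⊢ᴹ t ∶ A → Γ ⊢ᴹ t ≃ u ∶ A
etm-reflexive refl = etm-refl

D-≃ctx-refl : {Γ : Ctx n} → ⊢ Γ → ⊢ᴹ DCtx Γ ≃ctx DCtx Γ
D-≃ctx-refl c∅      = mce∅
D-≃ctx-refl (c▹ ⊢A) = mce▹ (D-≃ctx-refl (⊢ty⇒⊢ ⊢A)) (ety-refl (D-⊢ty ⊢A))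

mainTheorem8 : DesuspensionIsCwFMorphism
mainTheorem8 = record
  { D-ctx    = D-⊢
  ; D-ty     = D-⊢ty
  ; D-tm     = D-⊢tm
  ; D-sub    = D-⊢ₛ
  ; D-id     = λ {n} ⊢Γ → msub-reflexive (DSub-idSub n) (D-⊢ₛ (idSub-⊢ₛ ⊢Γ))
  ; D-comp   = λ {δ = δ} {γ} ⊢δ ⊢γ → msub-reflexive (DSub-∘ₛ γ δ) (D-⊢ₛ (∘ₛ-⊢ₛ ⊢γ ⊢δ))
  ; D-ty-sub = λ {A = A} {γ} ⊢A ⊢γ → ety-reflexive (DTy-[]Ty A γ) (D-⊢ty ([]-⊢ty ⊢A ⊢γ))
  ; D-tm-sub = λ {t = t} {γ = γ} ⊢t ⊢γ → etm-reflexive (DTm-[]Tm t γ) (D-⊢tm ([]-⊢tm ⊢t ⊢γ))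
  ; D-empty  = mce∅
  ; D-ext    = λ ⊢A → D-≃ctx-refl (c▹ ⊢A)
  ; D-p      = λ {n} ⊢A → msub-reflexive (DSub-pSub n) (D-⊢ₛ (pSub-⊢ₛ ⊢A))
  ; D-q      = λ {A = A} ⊢A →
      etm-refl (⊢ᴹ-retype (cong DTy (wkTy≡[pSub]Ty A)) (D-⊢tm (tvar (c▹ ⊢A))))
  ; D-pair   = λ ⊢γ ⊢A ⊢t → msub-refl (D-⊢ₛ (s, ⊢γ ⊢A ⊢t))
  }
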